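{- For every even integer $k\ge 2$, there exists a bipartite IRC-colorable graph $G$ with $\chi_{irc}(G)=k$.
   Context: All graphs are finite, simple, undirected and connected. Private neighbors. For $S\subseteq V(G)$ and $v\in S$, $pn[v,S]=N[v]\setminus\bigcup_{u\in S\setminus\{v\}}N[u]$, where $N[\cdot]$ is the closed neighborhood. $S$ is irredundant if $pn[v,S]\ne\emptyset$ for all $v\in S$. Rainbow committees and IRC-colorings. For a proper coloring of $G$ with nonempty color classes $V_1,\dots,V_k$, a rainbow committee is a set containing exactly one vertex of each color class. An irredundance compelling coloring (IRC-coloring) is a proper coloring in which every rainbow committee is an irredundant set. $G$ is IRC-colorable if it admits an IRC-coloring. Irredundance compelling chromatic number. For an IRC-colorable $G$, $\chi_{irc}(G)$ is the maximum number of colors used by an IRC-coloring of $G$. -}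

module Defs where

open import Data.Nat using (ℕ; suc)
open import Data.Fin using (Fin)
open import Data.Bool using (Bool; true; false)
open import Data.Product using (Σ; ∃; ∃-syntax; _×_; _,_)
open import Data.Sum using (_⊎_)
open import Relation.Binary.PropositionalEquality using (_≡_; _≢_)
open import Relation.Nullary using (¬_)
open import Function.Definitions using (Surjective)

record Graph (n : ℕ) : Set where
  field
    adj       : Fin n → Fin n → Bool
    symmetric : ∀ u v → adj u v ≡ adj v u
    irreflex  : ∀ v → adj v v ≡ false
open Graph public

Adj : ∀ {n} → Graph n → Fin n → Fin n → Set
Adj G u v = adj G u v ≡ true

data Walk {n} (G : Graph n) : Fin n → Fin n → Set where
  here : ∀ {v} → Walk G v v
  step : ∀ {u v w} → Adj G u v → Walk G v w → Walk G u w

Connected : ∀ {n} → Graph n → Set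
Connected G = ∀ u v → Walk G u v

-- Proper colorings with exactly m (nonempty) color classes:
-- c : Fin n → Fin m surjective, adjacent vertices get distinct colors.
ProperColoring : ∀ {n} → Graph n → (m : ℕ) → (Fin n → Fin m) → Set
ProperColoring G m c = ∀ u v → Adj G u v → c u ≢ c v

Coloring : ∀ {n} → Graph n → (m : ℕ) → (Fin n → Fin m) → Set
Coloring G m c = ProperColoring G m c × Surjective _≡_ _≡_ c

Bipartite : ∀ {n} → Graph n → Set
Bipartite G = ∃[ c ] ProperColoring G 2 c

InN : ∀ {n} → Graph n → Fin n → Fin n → Set
InN G v w = w ≡ v ⊎ Adj G v w

-- A rainbow committee of c : Fin n → Fin m is given by choosing, for each
-- color i, the vertex r i of color i; the committee is the image of r
-- (exactly one vertex from each color class).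
Rainbow : ∀ {n m} → (Fin n → Fin m) → (Fin m → Fin n) → Set
Rainbow c r = ∀ i → c (r i) ≡ i

IrredundantCommittee : ∀ {n m} → Graph n → (Fin m → Fin n) → Set
IrredundantCommittee G r =
  ∀ i → ∃[ w ] (InN G (r i) w × (∀ j → j ≢ i → ¬ InN G (r j) w))

IRCColoring : ∀ {n} → Graph n → (m : ℕ) → (Fin n → Fin m) → Set
IRCColoring G m c =
  Coloring G m c × (∀ r → Rainbow c r → IrredundantCommittee G r)

IRCColorable : ∀ {n} → Graph n → Set
IRCColorable G = ∃[ m ] ∃[ c ] IRCColoring G m c

open import Data.Nat using (_≤_)
ChiIrc≡ : ∀ {n} → Graph n → ℕ → Set
ChiIrc≡ G k = (∃[ c ] IRCColoring G k c) × (∀ m c → IRCColoring G m c → m ≤ k)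

{-# OPTIONS --safe #-}
module Submission where

-- Take k/2 copies of K₂,₃ with sides {a₀, a₁} and {b₀, b₁, b⋆}, and join b⋆ of the first copy
-- to b⋆ of every other copy; the result is connected and bipartite. Giving each side of each copy
-- its own colour is an IRC-colouring with k colours. Conversely, in any IRC-colouring two vertices
-- u, v with N(u) ⊆ N(v) and a common neighbour w have the same colour: otherwise a rainbow
-- committee through u, v and w leaves u without a private neighbour. Since a₀ and b₀ are joined
-- only to the other side of their copy, they are dominated in this sense by every vertex on their
-- own side, so each side of each copy is monochromatic and at most k colours are used.

open import Defs
open import Data.Bool using (Bool; true; false; not; _∧_; _xor_)
open import Data.Bool.Properties
  using ( xor-comm; xor-same; xor-identityʳ; xor-inverseˡ; not-distribʳ-xor; not-involutive; not-¬
        ; ∧-comm; ∧-conicalˡ; ∧-conicalʳ )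
open import Data.Empty using (⊥-elim)
open import Data.Fin using (Fin; zero; suc; combine; remQuot; _≟_)
open import Data.Fin.Properties
  using (remQuot-combine; combine-remQuot; combine-injective; combine-surjective; injective⇒≤; 2↔Bool)
open import Data.Nat using (ℕ; zero; suc; _≤_; _*_)
open import Data.Product using (∃-syntax; ∃₂; _×_; _,_; proj₁; proj₂)
open import Data.Sum using (_⊎_; inj₁; inj₂)
open import Function.Bundles using (Inverse)
open import Function.Definitions using (Surjective)
open import Relation.Binary.PropositionalEquality
open import Relation.Nullary using (¬_; yes; no)

Adj-sym : ∀ {n} (G : Graph n) {u v} → Adj G u v → Adj G v u
Adj-sym G {u} {v} uv = trans (symmetric G v u) uv

module _ {n} {G : Graph n} where

  _++ʷ_ : ∀ {u v w} → Walk G u v → Walk G v w → Walk G u w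
  here      ++ʷ q = q
  step uv p ++ʷ q = step uv (p ++ʷ q)

  reverseʷ : ∀ {u v} → Walk G u v → Walk G v u
  reverseʷ here        = here
  reverseʷ (step uv p) = reverseʷ p ++ʷ step (Adj-sym G uv) here

  connected-via : (hub : Fin n) → (∀ u → Walk G u hub) → Connected G
  connected-via hub toHub u v = toHub u ++ʷ reverseʷ (toHub v)

module _ {n m} {c : Fin n → Fin m} where

  override : (Fin m → Fin n) → Fin n → Fin m → Fin n
  override r v j with j ≟ c v
  ... | yes _ = v
  ... | no  _ = r j

  override-rainbow : ∀ {r} v → Rainbow c r → Rainbow c (override r v)
  override-rainbow v rainbow j with j ≟ c v
  ... | yes j≡cv = sym j≡cv
  ... | no  _    = rainbow j

  override-here : ∀ r v → override r v (c v) ≡ v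
  override-here r v with c v ≟ c v
  ... | yes _     = refl
  ... | no  cv≢cv = ⊥-elim (cv≢cv refl)

  override-elsewhere : ∀ r v {j} → j ≢ c v → override r v j ≡ r j
  override-elsewhere r v {j} j≢cv with j ≟ c v
  ... | yes j≡cv = ⊥-elim (j≢cv j≡cv)
  ... | no  _    = refl

  rainbow-through : Surjective _≡_ _≡_ c → ∀ u v w → c v ≢ c u → c w ≢ c u → c w ≢ c v →
    ∃[ r ] (Rainbow c r × r (c u) ≡ u × r (c v) ≡ v × r (c w) ≡ w)
  rainbow-through surj u v w cv≢cu cw≢cu cw≢cv =
    r , rainbow , override-here r₂ u ,
    trans (override-elsewhere r₂ u cv≢cu) (override-here r₁ v) ,
    trans (override-elsewhere r₂ u cw≢cu) (trans (override-elsewhere r₁ v cw≢cv) (override-here r₀ w))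
    where
    r₀ r₁ r₂ r : Fin m → Fin n
    r₀ j = proj₁ (surj j)
    r₁   = override r₀ w
    r₂   = override r₁ v
    r    = override r₂ u
    rainbow : Rainbow c r
    rainbow = override-rainbow u (override-rainbow v (override-rainbow w (λ j → proj₂ (surj j) refl)))

module _ {n m} {G : Graph n} {c : Fin n → Fin m} (irc : IRCColoring G m c) where

  closedNeighbourhood-uncovered : ∀ {u v w} → c v ≢ c u → c w ≢ c u → c w ≢ c v →
    ¬ (∀ x → InN G u x → InN G v x ⊎ InN G w x)
  closedNeighbourhood-uncovered {u} {v} {w} cv≢cu cw≢cu cw≢cv cover
    with rainbow-through (proj₂ (proj₁ irc)) u v w cv≢cu cw≢cu cw≢cv
  ... | r , rainbow , ru≡u , rv≡v , rw≡w
    with proj₂ irc r rainbow (c u)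
  ... | x , x∈N[ru] , private-x
    with cover x (subst (λ y → InN G y x) ru≡u x∈N[ru])
  ... | inj₁ x∈N[v] = private-x (c v) cv≢cu (subst (λ y → InN G y x) (sym rv≡v) x∈N[v])
  ... | inj₂ x∈N[w] = private-x (c w) cw≢cu (subst (λ y → InN G y x) (sym rw≡w) x∈N[w])

  dominated⇒same-colour : ∀ {u v} → (∀ x → Adj G x u → Adj G x v) →
    ∀ w → Adj G w u → Adj G w v → c u ≡ c v
  dominated⇒same-colour {u} {v} N[u]⊆N[v] w wu wv with c u ≟ c v
  ... | yes cu≡cv = cu≡cv
  ... | no  cu≢cv = ⊥-elim (closedNeighbourhood-uncovered
          (λ cv≡cu → cu≢cv (sym cv≡cu)) (proper wu) (proper wv) cover)
    where
    proper : ∀ {x y} → Adj G x y → c x ≢ c y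
    proper {x} {y} = proj₁ (proj₁ irc) x y
    cover : ∀ x → InN G u x → InN G v x ⊎ InN G w x
    cover x (inj₁ x≡u) = inj₂ (inj₂ (subst (Adj G w) (sym x≡u) wu))
    cover x (inj₂ ux)  = inj₁ (inj₂ (Adj-sym G (N[u]⊆N[v] x (Adj-sym G ux))))

coarser-surjection⇒≤ : ∀ {A : Set} {k m} (d : A → Fin k) (c : A → Fin m) →
  Surjective _≡_ _≡_ c → (∀ u v → d u ≡ d v → c u ≡ c v) → m ≤ k
coarser-surjection⇒≤ {k = k} {m} d c surj d-finer = injective⇒≤ section-injective
  where
  section : Fin m → Fin k
  section z = d (proj₁ (surj z))
  section-injective : ∀ {z z′} → section z ≡ section z′ → z ≡ z′
  section-injective {z} {z′} eq =
    trans (sym (proj₂ (surj z) refl)) (trans (d-finer _ _ eq) (proj₂ (surj z′) refl))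

xor≡true⇒≡not : ∀ x y → x xor y ≡ true → x ≡ not y
xor≡true⇒≡not true  y     eq   = sym eq
xor≡true⇒≡not false .true refl = refl

xor-not-≢ : ∀ z a → z xor not a ≢ z xor a
xor-not-≢ z a eq = not-¬ refl (trans (sym eq) (sym (not-distribʳ-xor z a)))

toFin2 : Bool → Fin 2
toFin2 = Inverse.from 2↔Bool

toFin2-injective : ∀ {a b} → toFin2 a ≡ toFin2 b → a ≡ b
toFin2-injective {a} {b} eq = trans (sym (strictlyInverseˡ a)) (trans (cong to eq) (strictlyInverseˡ b))
  where open Inverse 2↔Bool

pattern a₀ = zero
pattern a₁ = suc zero
pattern b₀ = suc (suc zero)
pattern b₁ = suc (suc (suc zero))
pattern b⋆ = suc (suc (suc (suc zero)))

inA : Fin 5 → Bool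
inA a₀ = true
inA a₁ = true
inA b₀ = false
inA b₁ = false
inA b⋆ = false

isConnector : Fin 5 → Bool
isConnector b⋆ = true
isConnector a₀ = false
isConnector a₁ = false
isConnector b₀ = false
isConnector b₁ = false

isConnector⇒≡b⋆ : ∀ t → isConnector t ≡ true → t ≡ b⋆
isConnector⇒≡b⋆ b⋆ _ = refl

representative : Bool → Fin 5
representative true  = a₀
representative false = b₀

inA-representative : ∀ b → inA (representative b) ≡ b
inA-representative true  = refl
inA-representative false = refl

representative-nonConnector : ∀ b → isConnector (representative b) ≡ false
representative-nonConnector true  = refl
representative-nonConnector false = refl

nonConnector-avoiding : ∀ b t → ∃[ s ] (inA s ≡ b × isConnector s ≡ false × s ≢ t)
nonConnector-avoiding true t with t ≟ a₀
... | yes refl = a₁ , refl , refl , λ ()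
... | no  t≢a₀ = a₀ , refl , refl , λ a₀≡t → t≢a₀ (sym a₀≡t)
nonConnector-avoiding false t with t ≟ b₀
... | yes refl = b₁ , refl , refl , λ ()
... | no  t≢b₀ = b₀ , refl , refl , λ b₀≡t → t≢b₀ (sym b₀≡t)

isZero : ∀ {h} → Fin h → Bool
isZero zero    = true
isZero (suc _) = false

-- Slot t of copy i is the vertex (i, t); the connectors b⋆ form a star centred in copy 0.
adjacent : ∀ {h} → Fin h → Fin 5 → Fin h → Fin 5 → Bool
adjacent i t j s with i ≟ j
... | yes _ = inA t xor inA s
... | no  _ = (isZero i xor isZero j) ∧ (isConnector t ∧ isConnector s)

module _ {h : ℕ} where

  adjacent-sym : ∀ (i : Fin h) t j s → adjacent i t j s ≡ adjacent j s i t
  adjacent-sym i t j s with i ≟ j | j ≟ i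
  ... | yes refl | yes _    = xor-comm (inA t) (inA s)
  ... | yes refl | no  i≢i  = ⊥-elim (i≢i refl)
  ... | no  i≢j  | yes refl = ⊥-elim (i≢j refl)
  ... | no  _    | no  _    =
    cong₂ _∧_ (xor-comm (isZero i) (isZero j)) (∧-comm (isConnector t) (isConnector s))

  adjacent-sameCopy : ∀ (i : Fin h) t s → adjacent i t i s ≡ inA t xor inA s
  adjacent-sameCopy i t s with i ≟ i
  ... | yes _   = refl
  ... | no  i≢i = ⊥-elim (i≢i refl)

  adjacent-irrefl : ∀ (i : Fin h) t → adjacent i t i t ≡ false
  adjacent-irrefl i t = trans (adjacent-sameCopy i t t) (xor-same (inA t))

  adjacent-nonConnector : ∀ (j : Fin h) t i s → isConnector s ≡ false →
    adjacent j t i s ≡ true → j ≡ i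
  adjacent-nonConnector j t i s s-nc jt~is with j ≟ i
  ... | yes j≡i = j≡i
  ... | no  _
    with trans (sym s-nc) (∧-conicalʳ (isConnector t) _ (∧-conicalʳ (isZero j xor isZero i) _ jt~is))
  ... | ()

  adjacent⇒parity≢ : ∀ (i : Fin h) t j s → adjacent i t j s ≡ true →
    isZero i xor inA t ≢ isZero j xor inA s
  adjacent⇒parity≢ i t j s it~js with i ≟ j
  ... | yes refl = λ eq → xor-not-≢ (isZero i) (inA s)
    (subst (λ a → isZero i xor a ≡ isZero i xor inA s) (xor≡true⇒≡not (inA t) (inA s) it~js) eq)
  ... | no _
    with isConnector⇒≡b⋆ t (∧-conicalˡ _ _ connectors)
       | isConnector⇒≡b⋆ s (∧-conicalʳ _ _ connectors)
    where
    connectors : isConnector t ∧ isConnector s ≡ true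
    connectors = ∧-conicalʳ (isZero i xor isZero j) _ it~js
  ... | refl | refl = λ eq → not-¬
    (trans (sym (xor-identityʳ (isZero i))) (trans eq (xor-identityʳ (isZero j))))
    (xor≡true⇒≡not (isZero i) (isZero j) (∧-conicalˡ _ (isConnector b⋆ ∧ isConnector b⋆) it~js))

module StarOfK₂,₃ (h : ℕ) where

  H : ℕ
  H = suc h

  copy : Fin (H * 5) → Fin H
  copy u = proj₁ (remQuot {H} 5 u)

  slot : Fin (H * 5) → Fin 5
  slot u = proj₂ (remQuot {H} 5 u)

  vertex : Fin H → Fin 5 → Fin (H * 5)
  vertex = combine

  copy-vertex : ∀ i t → copy (vertex i t) ≡ i
  copy-vertex i t = cong proj₁ (remQuot-combine {H} {5} i t)

  slot-vertex : ∀ i t → slot (vertex i t) ≡ t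
  slot-vertex i t = cong proj₂ (remQuot-combine {H} {5} i t)

  vertex-copy-slot : ∀ u → vertex (copy u) (slot u) ≡ u
  vertex-copy-slot = combine-remQuot {H} 5

  graph : Graph (H * 5)
  graph = record
    { adj       = λ u v → adjacent (copy u) (slot u) (copy v) (slot v)
    ; symmetric = λ u v → adjacent-sym (copy u) (slot u) (copy v) (slot v)
    ; irreflex  = λ v → adjacent-irrefl (copy v) (slot v)
    }

  adj-vertexʳ : ∀ u i s → adj graph u (vertex i s) ≡ adjacent (copy u) (slot u) i s
  adj-vertexʳ u i s rewrite copy-vertex i s | slot-vertex i s = refl

  adj-vertex : ∀ i t j s → adj graph (vertex i t) (vertex j s) ≡ adjacent i t j s
  adj-vertex i t j s = trans (adj-vertexʳ (vertex i t) j s)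
    (cong₂ (λ i′ t′ → adjacent i′ t′ j s) (copy-vertex i t) (slot-vertex i t))

  colourOf : Bool → Fin H → Fin (2 * H)
  colourOf b i = combine (toFin2 b) i

  colourOf-injective : ∀ {b i b′ i′} → colourOf b i ≡ colourOf b′ i′ → b ≡ b′ × i ≡ i′
  colourOf-injective {b} {i} {b′} {i′} eq with combine-injective (toFin2 b) i (toFin2 b′) i′ eq
  ... | b≡b′ , i≡i′ = toFin2-injective b≡b′ , i≡i′

  colourOf-surjective : ∀ y → ∃₂ λ b i → colourOf b i ≡ y
  colourOf-surjective y with combine-surjective {2} {H} y
  ... | j , i , refl =
    Inverse.to 2↔Bool j , i , cong (λ j′ → combine j′ i) (Inverse.strictlyInverseʳ 2↔Bool j)

  colour : Fin (H * 5) → Fin (2 * H)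
  colour u = colourOf (inA (slot u)) (copy u)

  colour-vertex : ∀ i t → colour (vertex i t) ≡ colourOf (inA t) i
  colour-vertex i t rewrite copy-vertex i t | slot-vertex i t = refl

  adj-of-colour : ∀ u i s → colour u ≡ colourOf (not (inA s)) i → Adj graph u (vertex i s)
  adj-of-colour u i s eq with colourOf-injective {inA (slot u)} {copy u} {not (inA s)} {i} eq
  ... | side , refl = begin
    adj graph u (vertex i s)  ≡⟨ adj-vertexʳ u i s ⟩
    adjacent i (slot u) i s   ≡⟨ adjacent-sameCopy i (slot u) s ⟩
    inA (slot u) xor inA s    ≡⟨ cong (_xor inA s) side ⟩
    not (inA s) xor inA s     ≡⟨ xor-inverseˡ (inA s) ⟩
    true                      ∎
    where open ≡-Reasoning

  colour-of-adj : ∀ u i s → isConnector s ≡ false → Adj graph u (vertex i s) →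
    colour u ≡ colourOf (not (inA s)) i
  colour-of-adj u i s s-nc u~s
    with adjacent-nonConnector (copy u) (slot u) i s s-nc (trans (sym (adj-vertexʳ u i s)) u~s)
  ... | refl = cong (λ b → colourOf b (copy u)) (xor≡true⇒≡not (inA (slot u)) (inA s) within)
    where
    within : inA (slot u) xor inA s ≡ true
    within = trans (sym (adjacent-sameCopy (copy u) (slot u) s)) (trans (sym (adj-vertexʳ u (copy u) s)) u~s)

  inner-edge : ∀ i t s → inA t ≡ not (inA s) → Adj graph (vertex i t) (vertex i s)
  inner-edge i t s side =
    adj-of-colour (vertex i t) i s (trans (colour-vertex i t) (cong (λ b → colourOf b i) side))

  hub : Fin (H * 5)
  hub = vertex zero b⋆

  toConnector : ∀ i t → Walk graph (vertex i t) (vertex i b⋆)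
  toConnector i a₀ = step (inner-edge i a₀ b⋆ refl) here
  toConnector i a₁ = step (inner-edge i a₁ b⋆ refl) here
  toConnector i b₀ = step (inner-edge i b₀ a₀ refl) (toConnector i a₀)
  toConnector i b₁ = step (inner-edge i b₁ a₀ refl) (toConnector i a₀)
  toConnector i b⋆ = here

  connectorToHub : ∀ i → Walk graph (vertex i b⋆) hub
  connectorToHub zero    = here
  connectorToHub (suc i) = step (adj-vertex (suc i) b⋆ zero b⋆) here

  connected : Connected graph
  connected = connected-via hub λ u → subst (λ x → Walk graph x hub) (vertex-copy-slot u)
    (toConnector (copy u) (slot u) ++ʷ connectorToHub (copy u))

  bipartite : Bipartite graph
  bipartite = (λ u → toFin2 (isZero (copy u) xor inA (slot u))) , λ u v u~v eq →
    adjacent⇒parity≢ (copy u) (slot u) (copy v) (slot v) u~v (toFin2-injective eq)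

  colour-proper : ProperColoring graph (2 * H) colour
  colour-proper u v u~v eq with colourOf-injective {inA (slot u)} {copy u} {inA (slot v)} {copy v} eq
  ... | same-side , same-copy = not-¬ same-side (xor≡true⇒≡not (inA (slot u)) (inA (slot v)) within)
    where
    within : inA (slot u) xor inA (slot v) ≡ true
    within = trans (sym (adjacent-sameCopy (copy v) (slot u) (slot v)))
                   (subst (λ k → adjacent k (slot u) (copy v) (slot v) ≡ true) same-copy u~v)

  colour-surjective : Surjective _≡_ _≡_ colour
  colour-surjective y with colourOf-surjective y
  ... | b , i , refl = vertex i (representative b) , λ { refl →
    trans (colour-vertex i (representative b)) (cong (λ b′ → colourOf b′ i) (inA-representative b)) }

  -- The private neighbour of the member coloured (b, i) is a non-connector slot of copy i on the
  -- other side, distinct from the member chosen on that side.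
  colour-irredundant : ∀ r → Rainbow colour r → IrredundantCommittee graph r
  colour-irredundant r rainbow y with colourOf-surjective y
  ... | b , i , refl with nonConnector-avoiding (not b) (slot (r (colourOf (not b) i)))
  ... | s , s-side , s-nc , s≢t =
    vertex i s , inj₂ (adj-of-colour (r (colourOf b i)) i s member-colour) , unshared
    where
    colourOf-opposite : colourOf (not (inA s)) i ≡ colourOf b i
    colourOf-opposite = cong (λ b′ → colourOf b′ i) (trans (cong not s-side) (not-involutive b))
    member-colour : colour (r (colourOf b i)) ≡ colourOf (not (inA s)) i
    member-colour = trans (rainbow _) (sym colourOf-opposite)
    unshared : ∀ j → j ≢ colourOf b i → ¬ InN graph (r j) (vertex i s)
    unshared j j≢y (inj₁ s≡rj) =
      s≢t (trans (sym (slot-vertex i s)) (cong slot (trans s≡rj (cong r j≡opposite))))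
      where
      j≡opposite : j ≡ colourOf (not b) i
      j≡opposite = trans (sym (rainbow j)) (trans (cong colour (sym s≡rj))
        (trans (colour-vertex i s) (cong (λ b′ → colourOf b′ i) s-side)))
    unshared j j≢y (inj₂ rj~s) =
      j≢y (trans (sym (rainbow j)) (trans (colour-of-adj (r j) i s s-nc rj~s) colourOf-opposite))

  colour-IRC : IRCColoring graph (2 * H) colour
  colour-IRC = (colour-proper , colour-surjective) , colour-irredundant

  module _ {m} {c : Fin (H * 5) → Fin m} (irc : IRCColoring graph m c) where

    side-monochromatic : ∀ i t → c (vertex i (representative (inA t))) ≡ c (vertex i t)
    side-monochromatic i t =
      dominated⇒same-colour {G = graph} irc dominated (vertex i (representative (not b)))
      (inner-edge i (representative (not b)) (representative b) opposite-representative)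
      (inner-edge i (representative (not b)) t (inA-representative (not b)))
      where
      b : Bool
      b = inA t
      opposite-representative : inA (representative (not b)) ≡ not (inA (representative b))
      opposite-representative =
        trans (inA-representative (not b)) (cong not (sym (inA-representative b)))
      dominated : ∀ x → Adj graph x (vertex i (representative b)) → Adj graph x (vertex i t)
      dominated x x~rep = adj-of-colour x i t (trans
        (colour-of-adj x i (representative b) (representative-nonConnector b) x~rep)
        (cong (λ b′ → colourOf (not b′) i) (inA-representative b)))

    colour-bound : m ≤ 2 * H
    colour-bound = coarser-surjection⇒≤ colour c (proj₂ (proj₁ irc)) colour-finer
      where
      colour-finer : ∀ u v → colour u ≡ colour v → c u ≡ c v
      colour-finer u v eq with colourOf-injective {inA (slot u)} {copy u} {inA (slot v)} {copy v} eq
      ... | same-side , same-copy = begin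
        c u                                                  ≡⟨ cong c (sym (vertex-copy-slot u)) ⟩
        c (vertex (copy u) (slot u))                         ≡⟨ sym (side-monochromatic (copy u) (slot u)) ⟩
        c (vertex (copy u) (representative (inA (slot u))))
          ≡⟨ cong₂ (λ i b → c (vertex i (representative b))) same-copy same-side ⟩
        c (vertex (copy v) (representative (inA (slot v))))  ≡⟨ side-monochromatic (copy v) (slot v) ⟩
        c (vertex (copy v) (slot v))                         ≡⟨ cong c (vertex-copy-slot v) ⟩
        c v                                                  ∎
        where open ≡-Reasoning

proposition7 : ∀ (k : ℕ) → 2 ≤ k → (∃[ h ] k ≡ 2 * h) →
    ∃[ n ] ∃[ G ] (Connected {n} G × Bipartite G × IRCColorable G × ChiIrc≡ G k)
proposition7 _ () (zero , refl)
proposition7 _ _  (suc h , refl) =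
  _ , graph , connected , bipartite , (_ , colour , colour-IRC) ,
  ((colour , colour-IRC) , λ _ _ → colour-bound)
  where open StarOfK₂,₃ h
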